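{- Let $w$ be a word in the letters $1,\dots,k$ in which each letter occurs exactly $n$ times. Then \[ \mathrm{charge}(w)=\sum_{j=1}^{k-1}\mathrm{depth}_j(w)\,(k-j). \]
   Context: For $1\le j\le k-1$, $\mathrm{depth}_j(w)$ is defined as follows: take the subword of $w$ consisting of the letters $j$ and $j+1$, and repeatedly delete adjacent pairs consisting of a $j+1$ immediately followed by a $j$; the result has the form $j^r(j+1)^s$, and $\mathrm{depth}_j(w)=s$. For a permutation $\pi$ of $[r]$ (one-line notation), $\mathrm{charge}(\pi)=\mathrm{maj}(\mathrm{rev}(\pi^{ -1}))$, where maj is the sum of descent positions and rev is reversal. A word with partition content $(v_1,v_2,\dots)$ is split into $v_1$ standard subwords: take the rightmost $1$, then move left to the first $2$, then left to the first $3$, etc., wrapping around to the right end of the word if the needed letter does not occur to the left, as long as possible; these letters (in original order) form the first subword; repeat on the unused letters. $\mathrm{charge}(w)$ is the sum of the charges of its standard subwords. -}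

module Defs where

open import Data.Nat using (ℕ; zero; suc; _+_; _*_; _∸_; _<ᵇ_; _≡ᵇ_; _≤_; _≟_)
open import Data.Bool using (Bool; true; false; _∧_; _∨_; not; if_then_else_)
open import Data.Maybe using (Maybe; just; nothing)
open import Data.List using (List; []; _∷_; length; map; filter; upTo; reverse; _++_)
open import Data.Nat.ListAction using (sum)
open import Data.Bool.ListAction using (any)

-- Words are lists of natural numbers (letters), positions are 0-indexed.

-- letter at position p (0 if out of range)
letterAt : List ℕ → ℕ → ℕ
letterAt [] _ = 0
letterAt (x ∷ _) zero = x
letterAt (_ ∷ xs) (suc p) = letterAt xs p

occ : ℕ → List ℕ → ℕ
occ c w = length (filter (λ x → Data.Bool.T? (x ≡ᵇ c)) w)
  where import Data.Bool

deletePair : ℕ → List ℕ → List ℕ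
deletePair j [] = []
deletePair j (x ∷ []) = x ∷ []
deletePair j (x ∷ y ∷ xs) =
  if (x ≡ᵇ suc j) ∧ (y ≡ᵇ j) then xs else x ∷ deletePair j (y ∷ xs)

-- iterate deletion (fuel-bounded; length of the word suffices)
iterDelete : ℕ → ℕ → List ℕ → List ℕ
iterDelete j zero u = u
iterDelete j (suc f) u = iterDelete j f (deletePair j u)

subwordJ : ℕ → List ℕ → List ℕ
subwordJ j w = filter (λ x → Data.Bool.T? ((x ≡ᵇ j) ∨ (x ≡ᵇ suc j))) w
  where import Data.Bool

-- reduced word  j^r (j+1)^s ;  depth_j(w) = s
reducedJ : ℕ → List ℕ → List ℕ
reducedJ j w = iterDelete j (length (subwordJ j w)) (subwordJ j w)

depth : ℕ → List ℕ → ℕ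
depth j w = occ (suc j) (reducedJ j w)

-- charge of a permutation (one-line notation, values 1..r)

-- 1-indexed position of value i in π (0 if absent)
posOf : ℕ → List ℕ → ℕ
posOf i [] = 0
posOf i (x ∷ xs) = if x ≡ᵇ i then 1 else (if posOf i xs ≡ᵇ 0 then 0 else suc (posOf i xs))

inversePerm : List ℕ → List ℕ
inversePerm π = map (λ i → posOf (suc i) π) (upTo (length π))

-- maj with 1-indexed descent positions; the first argument is the
-- position of the head of the list
majFrom : ℕ → List ℕ → ℕ
majFrom p [] = 0
majFrom p (x ∷ []) = 0
majFrom p (x ∷ y ∷ xs) = (if y <ᵇ x then p else 0) + majFrom (suc p) (y ∷ xs)

maj : List ℕ → ℕ
maj l = majFrom 1 l

chargePerm : List ℕ → ℕ
chargePerm π = maj (reverse (inversePerm π))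

memb : ℕ → List ℕ → Bool
memb p used = any (λ q → q ≡ᵇ p) used

avail : List ℕ → List ℕ → ℕ → ℕ → Bool
avail w used c p = (p <ᵇ length w) ∧ (letterAt w p ≡ᵇ c) ∧ not (memb p used)

searchBetween : List ℕ → List ℕ → ℕ → ℕ → ℕ → Maybe ℕ
searchBetween w used c lo zero = nothing
searchBetween w used c lo (suc h) =
  if not (h <ᵇ lo) ∧ avail w used c h then just h
  else searchBetween w used c lo h

-- from position p, move left to the first unused c, wrapping around
-- to the right end of the word if necessary
nextPos : List ℕ → List ℕ → ℕ → ℕ → Maybe ℕ
nextPos w used c p with searchBetween w used c 0 p
... | just q = just q
... | nothing = searchBetween w used c (suc p) (length w)

extend : ℕ → List ℕ → List ℕ → ℕ → ℕ → List ℕ → List ℕ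
extend zero w used c p acc = acc
extend (suc f) w used c p acc with nextPos w (acc ++ used) (suc c) p
... | just q = extend f w used (suc c) q (q ∷ acc)
... | nothing = acc

extractPositions : List ℕ → List ℕ → List ℕ
extractPositions w used with searchBetween w used 1 0 (length w)
... | just p = extend (length w) w used 1 p (p ∷ [])
... | nothing = []

lettersAt : List ℕ → List ℕ → List ℕ
lettersAt w ps = map (letterAt w) (filter (λ p → Data.Bool.T? (memb p ps)) (upTo (length w)))
  where import Data.Bool

subwordsFrom : ℕ → List ℕ → List ℕ → List (List ℕ)
subwordsFrom zero w used = []
subwordsFrom (suc f) w used =
  lettersAt w ps ∷ subwordsFrom f w (ps ++ used)
  where ps = extractPositions w used

standardSubwords : List ℕ → List (List ℕ)
standardSubwords w = subwordsFrom (occ 1 w) w []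

charge : List ℕ → ℕ
charge w = sum (map chargePerm (standardSubwords w))

depthSum : ℕ → List ℕ → ℕ
depthSum k w = sum (map (λ j → depth j w * (k ∸ j)) (map suc (upTo (k ∸ 1))))

module Submission where

-- For a letter j ≥ 1 let  excess j u = #(j+1) - #j  in u (truncated at 0)
-- and let  maxExcess j u  be the largest excess of a suffix of u.
--  * depth: deleting an adjacent pair (j+1) j does not change maxExcess, and
--    on a fully reduced word j^r (j+1)^s it equals s; so depth_j = maxExcess j.
--  * charge of a permutation σ of length k is Σ_{j<k} [pos j < pos (j+1)] (k-j).
--  * one round of the standard-subword decomposition picks positions
--    p_1, …, p_k of the letters 1, …, k.  Blanking them out (replacing them by
--    the non-letter 0) lowers maxExcess j by exactly [p_j < p_{j+1}]: if the
--    search for j+1 did not wrap around, p_{j+1} < p_j are a cancelling pair;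
--    if it wrapped, no j+1 lies outside [p_j, p_{j+1}] and, the remaining word
--    being balanced, the suffix maximum drops by one.
-- Summing over rounds, each round contributes its charge to the left-hand
-- side and the same amount to the drop of Σ_j maxExcess j · (k - j); after
-- the last round no letter j+1 is left, and the theorem follows.

open import Defs
open import Data.Nat
open import Data.Nat.Properties
open import Data.Bool using (Bool; true; false; _∧_; _∨_; if_then_else_; T; T?)
open import Data.Bool.Properties using (∧-conicalˡ; ∧-conicalʳ; ∨-conicalʳ; ∨-zeroʳ)
open import Data.Unit using (⊤; tt)
open import Data.Maybe using (Maybe; just; nothing; fromMaybe)
open import Data.List using (List; []; _∷_; length; map; filter; upTo; reverse; _++_; drop; applyUpTo)
open import Data.List.Properties using (map-++; reverse-++; upTo-∷ʳ; length-map; length-filter; length-upTo)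
open import Data.Nat.ListAction using (sum)
open import Data.Nat.ListAction.Properties using (sum-++)
open import Data.List.Relation.Unary.All using (All; []; _∷_; lookup)
open import Data.List.Relation.Unary.AllPairs using (AllPairs; []; _∷_)
open import Data.List.Relation.Unary.AllPairs.Properties using (filter⁺; applyUpTo⁺₁)
open import Data.List.Relation.Unary.Any using (here; there)
open import Data.List.Membership.Propositional using (_∈_)
open import Data.List.Membership.Propositional.Properties using (∈-map⁺; ∈-filter⁺; ∈-filter⁻; ∈-upTo⁺)
open import Data.Product using (_×_; _,_; proj₁; proj₂; Σ; ∃)
open import Data.Sum using (_⊎_; inj₁; inj₂)
open import Data.Empty using (⊥-elim)
open import Relation.Nullary using (yes; no)
open import Relation.Binary.PropositionalEquality
open import Function using (id)

true≢false : true ≢ false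
true≢false ()

≡ᵇ-sound : ∀ m n → (m ≡ᵇ n) ≡ true → m ≡ n
≡ᵇ-sound m n e = ≡ᵇ⇒≡ m n (subst T (sym e) tt)

≡ᵇ-refl : ∀ n → (n ≡ᵇ n) ≡ true
≡ᵇ-refl zero = refl
≡ᵇ-refl (suc n) = ≡ᵇ-refl n

≢⇒≡ᵇ-false : ∀ m n → m ≢ n → (m ≡ᵇ n) ≡ false
≢⇒≡ᵇ-false m n ne with m ≡ᵇ n in eq
... | true = ⊥-elim (ne (≡ᵇ-sound m n eq))
... | false = refl

<⇒<ᵇ-true : ∀ m n → m < n → (m <ᵇ n) ≡ true
<⇒<ᵇ-true m n lt with m <ᵇ n in eq
... | true = refl
... | false = ⊥-elim (subst T eq (<⇒<ᵇ lt))

≥⇒<ᵇ-false : ∀ m n → n ≤ m → (m <ᵇ n) ≡ false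
≥⇒<ᵇ-false m n le with m <ᵇ n in eq
... | false = refl
... | true = ⊥-elim (<⇒≱ (<ᵇ⇒< m n (subst T (sym eq) tt)) le)

bit : Bool → ℕ
bit true = 1
bit false = 0

bit-≡ᵇ-refl : ∀ n → bit (n ≡ᵇ n) ≡ 1
bit-≡ᵇ-refl n rewrite ≡ᵇ-refl n = refl

count : ℕ → List ℕ → ℕ
count c [] = 0
count c (x ∷ u) = bit (x ≡ᵇ c) + count c u

occ≡count : ∀ c u → occ c u ≡ count c u
occ≡count c [] = refl
occ≡count c (x ∷ u) with x ≡ᵇ c
... | true = cong suc (occ≡count c u)
... | false = occ≡count c u

count-absent : ∀ c u → (∀ h → letterAt u h ≢ c) → count c u ≡ 0
count-absent c [] _ = refl
count-absent c (x ∷ u) hyp rewrite ≢⇒≡ᵇ-false x c (hyp 0) = count-absent c u (λ h → hyp (suc h))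

count-positive : ∀ c u → 1 ≤ count c u → ∃ λ h → letterAt u h ≡ c
count-positive c [] ()
count-positive c (x ∷ u) le with x ≡ᵇ c in eq
... | true = 0 , ≡ᵇ-sound x c eq
... | false with count-positive c u le
... | h , e = suc h , e

letterAt-out : ∀ w p → length w ≤ p → letterAt w p ≡ 0
letterAt-out [] p _ = refl
letterAt-out (x ∷ w) (suc p) (s≤s le) = letterAt-out w p le

letterAt-extensional : ∀ u v → length u ≡ length v → (∀ p → letterAt u p ≡ letterAt v p) → u ≡ v
letterAt-extensional [] [] _ _ = refl
letterAt-extensional (x ∷ u) (y ∷ v) l e = cong₂ _∷_ (e 0) (letterAt-extensional u v (suc-injective l) (λ p → e (suc p)))

letterAt-drop : ∀ γ u h → letterAt (drop γ u) h ≡ letterAt u (γ + h)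
letterAt-drop zero u h = refl
letterAt-drop (suc γ) [] h = refl
letterAt-drop (suc γ) (x ∷ u) h = letterAt-drop γ u h

drop-at-letter : ∀ γ t x → letterAt t γ ≡ x → x ≢ 0 → drop γ t ≡ x ∷ drop (suc γ) t
drop-at-letter γ [] x e x≢0 = ⊥-elim (x≢0 (sym e))
drop-at-letter zero (y ∷ t) x e x≢0 = cong (_∷ t) e
drop-at-letter (suc γ) (y ∷ t) x e x≢0 = drop-at-letter γ t x e x≢0

count-drop-≤ : ∀ c γ t → count c (drop γ t) ≤ count c t
count-drop-≤ c zero t = ≤-refl
count-drop-≤ c (suc γ) [] = ≤-refl
count-drop-≤ c (suc γ) (x ∷ t) = ≤-trans (count-drop-≤ c γ t) (m≤n+m (count c t) (bit (x ≡ᵇ c)))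

count-drop-absent : ∀ c γ t → (∀ h → h < γ → letterAt t h ≢ c) → count c (drop γ t) ≡ count c t
count-drop-absent c zero t _ = refl
count-drop-absent c (suc γ) [] _ = refl
count-drop-absent c (suc γ) (x ∷ t) hyp rewrite ≢⇒≡ᵇ-false x c (hyp 0 (s≤s z≤n)) =
  count-drop-absent c γ t (λ h lt → hyp (suc h) (s≤s lt))

-- Erasing position q: its letter is replaced by the blank 0, which is not a
-- letter of the alphabet.  Removing letters this way keeps all positions fixed.
erase : ℕ → List ℕ → List ℕ
erase q [] = []
erase zero (x ∷ u) = 0 ∷ u
erase (suc q) (x ∷ u) = x ∷ erase q u

letterAt-erase : ∀ q u p → letterAt (erase q u) p ≡ (if q ≡ᵇ p then 0 else letterAt u p)
letterAt-erase q [] p with q ≡ᵇ p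
... | true = refl
... | false = refl
letterAt-erase zero (x ∷ u) zero = refl
letterAt-erase zero (x ∷ u) (suc p) = refl
letterAt-erase (suc q) (x ∷ u) zero = refl
letterAt-erase (suc q) (x ∷ u) (suc p) = letterAt-erase q u p

length-erase : ∀ q u → length (erase q u) ≡ length u
length-erase q [] = refl
length-erase zero (x ∷ u) = refl
length-erase (suc q) (x ∷ u) = cong suc (length-erase q u)

drop-erase-before : ∀ q γ u → q < γ → drop γ (erase q u) ≡ drop γ u
drop-erase-before q γ [] lt = refl
drop-erase-before zero (suc γ) (x ∷ u) lt = refl
drop-erase-before (suc q) (suc γ) (x ∷ u) (s≤s lt) = drop-erase-before q γ u lt

drop-erase-after : ∀ γ q u → drop γ (erase (γ + q) u) ≡ erase q (drop γ u)
drop-erase-after zero q u = refl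
drop-erase-after (suc γ) q [] = refl
drop-erase-after (suc γ) q (x ∷ u) = drop-erase-after γ q u

count-erase-other : ∀ c q u → c ≢ 0 → letterAt u q ≢ c → count c (erase q u) ≡ count c u
count-erase-other c q [] _ _ = refl
count-erase-other c zero (x ∷ u) c≢0 ne rewrite ≢⇒≡ᵇ-false 0 c (λ e → c≢0 (sym e)) | ≢⇒≡ᵇ-false x c ne = refl
count-erase-other c (suc q) (x ∷ u) c≢0 ne = cong (bit (x ≡ᵇ c) +_) (count-erase-other c q u c≢0 ne)

count-erase-same : ∀ c q u → c ≢ 0 → letterAt u q ≡ c → suc (count c (erase q u)) ≡ count c u
count-erase-same c q [] c≢0 e = ⊥-elim (c≢0 (sym e))
count-erase-same c zero (x ∷ u) c≢0 e rewrite ≢⇒≡ᵇ-false 0 c (λ e → c≢0 (sym e)) | e | ≡ᵇ-refl c = refl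
count-erase-same c (suc q) (x ∷ u) c≢0 e =
  trans (sym (+-suc (bit (x ≡ᵇ c)) _)) (cong (bit (x ≡ᵇ c) +_) (count-erase-same c q u c≢0 e))

-- Blanking a whole set U of positions (offset o = position of the head).
-- The decomposition into standard subwords is described by blanking the
-- positions already used.
mask : List ℕ → ℕ → List ℕ → List ℕ
mask U o [] = []
mask U o (x ∷ w) = (if memb o U then 0 else x) ∷ mask U (suc o) w

length-mask : ∀ U o w → length (mask U o w) ≡ length w
length-mask U o [] = refl
length-mask U o (x ∷ w) = cong suc (length-mask U (suc o) w)

letterAt-mask : ∀ U o w p → letterAt (mask U o w) p ≡ (if memb (o + p) U then 0 else letterAt w p)
letterAt-mask U o [] p with memb (o + p) U
... | true = refl
... | false = refl
letterAt-mask U o (x ∷ w) zero rewrite +-identityʳ o = refl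
letterAt-mask U o (x ∷ w) (suc p) rewrite +-suc o p = letterAt-mask U (suc o) w p

mask-nil : ∀ o w → mask [] o w ≡ w
mask-nil o [] = refl
mask-nil o (x ∷ w) = cong (x ∷_) (mask-nil (suc o) w)

mask-cons : ∀ q V w → mask (q ∷ V) 0 w ≡ erase q (mask V 0 w)
mask-cons q V w = letterAt-extensional _ _ lengths letters
  where
  lengths : length (mask (q ∷ V) 0 w) ≡ length (erase q (mask V 0 w))
  lengths = trans (length-mask (q ∷ V) 0 w) (sym (trans (length-erase q (mask V 0 w)) (length-mask V 0 w)))
  letters : ∀ p → letterAt (mask (q ∷ V) 0 w) p ≡ letterAt (erase q (mask V 0 w)) p
  letters p rewrite letterAt-mask (q ∷ V) 0 w p | letterAt-erase q (mask V 0 w) p | letterAt-mask V 0 w p with q ≡ᵇ p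
  ... | true = refl
  ... | false = refl

blanked : List ℕ → List ℕ → List ℕ
blanked w U = mask U 0 w

letterAt-blanked : ∀ w U p → letterAt (blanked w U) p ≡ (if memb p U then 0 else letterAt w p)
letterAt-blanked w U p = letterAt-mask U 0 w p

excess : ℕ → List ℕ → ℕ
excess j u = count (suc j) u ∸ count j u

maxExcess : ℕ → List ℕ → ℕ
maxExcess j [] = 0
maxExcess j (x ∷ u) = excess j (x ∷ u) ⊔ maxExcess j u

∸-suc-both : ∀ a b c d → (a + suc b) ∸ (c + suc d) ≡ (a + b) ∸ (c + d)
∸-suc-both a b c d rewrite +-suc a b | +-suc c d = refl

-- Throughout, j ≥ 1 is a letter, so neither j nor j+1 is the blank 0.
module MaxExcess (j : ℕ) (j≢0 : j ≢ 0) where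

  sj≢0 : suc j ≢ 0
  sj≢0 ()

  j≢sj : j ≢ suc j
  j≢sj e = 1+n≢n (sym e)

  sj≡ᵇj : (suc j ≡ᵇ j) ≡ false
  sj≡ᵇj = ≢⇒≡ᵇ-false (suc j) j (λ e → j≢sj (sym e))

  NoUpperBefore : ℕ → List ℕ → Set
  NoUpperBefore γ u = ∀ h → h < γ → letterAt u h ≢ suc j

  no-upper-through : ∀ α u → letterAt u α ≡ j → NoUpperBefore α u → NoUpperBefore (suc α) u
  no-upper-through α u eα nu h (s≤s h≤α) with m≤n⇒m<n∨m≡n h≤α
  ... | inj₁ h<α = nu h h<α
  ... | inj₂ refl = λ e → j≢sj (trans (sym eα) e)

  excess≤maxExcess : ∀ u → excess j u ≤ maxExcess j u
  excess≤maxExcess [] = ≤-refl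
  excess≤maxExcess (x ∷ u) = m≤m⊔n _ _

  excess-cons-≤ : ∀ x u → x ≢ suc j → excess j (x ∷ u) ≤ excess j u
  excess-cons-≤ x u ne rewrite ≢⇒≡ᵇ-false x (suc j) ne = ∸-monoʳ-≤ (count (suc j) u) (m≤n+m (count j u) (bit (x ≡ᵇ j)))

  -- A suffix starting with anything but j+1 never realises a new maximum, so
  -- leading letters other than j+1 can be dropped.
  maxExcess-cons-skip : ∀ x u → x ≢ suc j → maxExcess j (x ∷ u) ≡ maxExcess j u
  maxExcess-cons-skip x u ne = m≤n⇒m⊔n≡n (≤-trans (excess-cons-≤ x u ne) (excess≤maxExcess u))

  maxExcess-drop : ∀ γ u → NoUpperBefore γ u → maxExcess j u ≡ maxExcess j (drop γ u)
  maxExcess-drop zero u _ = refl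
  maxExcess-drop (suc γ) [] _ = refl
  maxExcess-drop (suc γ) (x ∷ u) nu =
    trans (maxExcess-cons-skip x u (nu 0 (s≤s z≤n))) (maxExcess-drop γ u (λ h lt → nu (suc h) (s≤s lt)))

  maxExcess-no-upper : ∀ u → count (suc j) u ≡ 0 → maxExcess j u ≡ 0
  maxExcess-no-upper [] _ = refl
  maxExcess-no-upper (x ∷ u) e with x ≡ᵇ suc j
  maxExcess-no-upper (x ∷ u) e | false rewrite e | maxExcess-no-upper u e | 0∸n≡0 (bit (x ≡ᵇ j) + count j u) = refl
  maxExcess-no-upper (x ∷ u) () | true

  maxExcess-erase-other : ∀ q u → letterAt u q ≢ j → letterAt u q ≢ suc j → maxExcess j (erase q u) ≡ maxExcess j u
  maxExcess-erase-other q [] _ _ = refl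
  maxExcess-erase-other zero (x ∷ u) n1 n2
    rewrite ≢⇒≡ᵇ-false 0 j (λ e → j≢0 (sym e)) | ≢⇒≡ᵇ-false x j n1 | ≢⇒≡ᵇ-false x (suc j) n2 = refl
  maxExcess-erase-other (suc q) (x ∷ u) n1 n2
    rewrite count-erase-other j q u j≢0 n1 | count-erase-other (suc j) q u sj≢0 n2
          | maxExcess-erase-other q u n1 n2 = refl

  -- If the first j of t (before any j+1) sits at α, then a leading j+1 is
  -- cancelled by it: the maximum is that of the suffix after α.
  maxExcess-cancel-head : ∀ α t → letterAt t α ≡ j → NoUpperBefore α t
    → maxExcess j (suc j ∷ t) ≡ maxExcess j (drop (suc α) t)
  maxExcess-cancel-head α t eα nu = trans (m≤n⇒m⊔n≡n head≤) same
    where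
    r = drop (suc α) t
    nu′ = no-upper-through α t eα nu
    same : maxExcess j t ≡ maxExcess j r
    same = maxExcess-drop (suc α) t nu′
    uppers : count (suc j) r ≡ count (suc j) t
    uppers = count-drop-absent (suc j) (suc α) t nu′
    lowers : suc (count j r) ≤ count j t
    lowers = subst (_≤ count j t) (trans (cong (count j) (drop-at-letter α t j eα j≢0)) (cong (_+ count j r) (bit-≡ᵇ-refl j)))
                   (count-drop-≤ j α t)
    head≤ : excess j (suc j ∷ t) ≤ maxExcess j t
    head≤ rewrite ≡ᵇ-refl (suc j) | sj≡ᵇj | sym uppers =
      ≤-trans (∸-monoʳ-≤ (suc (count (suc j) r)) lowers) (≤-trans (excess≤maxExcess r) (≤-reflexive (sym same)))

  -- After erasing that j, the prefix up to α contains no j+1 at all.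
  maxExcess-erase-first-lower : ∀ α t → letterAt t α ≡ j → NoUpperBefore α t
    → maxExcess j (erase α t) ≡ maxExcess j (drop (suc α) t)
  maxExcess-erase-first-lower α t eα nu =
    trans (maxExcess-drop (suc α) (erase α t) nu′) (cong (maxExcess j) (drop-erase-before α (suc α) t ≤-refl))
    where
    nu′ : NoUpperBefore (suc α) (erase α t)
    nu′ h lt rewrite letterAt-erase α t h with α ≡ᵇ h in eq
    ... | true = λ ()
    ... | false = no-upper-through α t eα nu h lt

  excess-erase-pair : ∀ x α β t → letterAt t α ≡ j → letterAt t β ≡ suc j
    → excess j (x ∷ erase β (erase α t)) ≡ excess j (x ∷ t)
  excess-erase-pair x α β t eα eβ = unchanged
    where
    t′ = erase β (erase α t)
    α≢β : α ≢ β
    α≢β e = j≢sj (trans (sym eα) (trans (cong (letterAt t) e) eβ))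
    eβ′ : letterAt (erase α t) β ≡ suc j
    eβ′ rewrite letterAt-erase α t β | ≢⇒≡ᵇ-false α β α≢β = eβ
    uppers : count (suc j) t ≡ suc (count (suc j) t′)
    uppers = trans (sym (count-erase-other (suc j) α t sj≢0 (λ e → j≢sj (trans (sym eα) e))))
                   (sym (count-erase-same (suc j) β (erase α t) sj≢0 eβ′))
    lowers : count j t ≡ suc (count j t′)
    lowers = trans (sym (count-erase-same j α t j≢0 eα))
                   (cong suc (sym (count-erase-other j β (erase α t) j≢0 (λ e → j≢sj (trans (sym e) eβ′)))))
    unchanged : excess j (x ∷ t′) ≡ excess j (x ∷ t)
    unchanged rewrite uppers | lowers = sym (∸-suc-both (bit (x ≡ᵇ suc j)) _ (bit (x ≡ᵇ j)) _)

  -- Non-wrapping step: a j+1 at β followed, with no j+1 in between, by a j at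
  -- α is a cancelling pair; erasing both does not change maxExcess.
  maxExcess-erase-nested : ∀ β α u → β < α → letterAt u β ≡ suc j → letterAt u α ≡ j
     → (∀ h → β < h → h < α → letterAt u h ≢ suc j)
     → maxExcess j (erase β (erase α u)) ≡ maxExcess j u
  maxExcess-erase-nested β α [] lt eβ eα between = refl
  maxExcess-erase-nested zero (suc α) (x ∷ t) lt refl eα between =
    trans (maxExcess-cons-skip 0 (erase α t) (λ ()))
      (trans (maxExcess-erase-first-lower α t eα nu) (sym (maxExcess-cancel-head α t eα nu)))
    where
    nu : NoUpperBefore α t
    nu h h<α = between (suc h) (s≤s z≤n) (s≤s h<α)
  maxExcess-erase-nested (suc β) (suc α) (x ∷ t) (s≤s lt) eβ eα between =
    cong₂ _⊔_ (excess-erase-pair x α β t eα eβ)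
              (maxExcess-erase-nested β α t lt eβ eα (λ h a b → between (suc h) (s≤s a) (s≤s b)))

  maxExcess-erase-last-upper : ∀ β t → letterAt t β ≡ suc j → (∀ h → β < h → letterAt t h ≢ suc j)
      → maxExcess j (erase β t) ≡ maxExcess j t ∸ 1
  maxExcess-erase-last-upper β [] e after = refl
  maxExcess-erase-last-upper zero (x ∷ post) e after
    rewrite e | ≡ᵇ-refl (suc j) | sj≡ᵇj | ≢⇒≡ᵇ-false 0 j (λ e → j≢0 (sym e))
          | count-absent (suc j) post (λ h → after (suc h) (s≤s z≤n))
          | maxExcess-no-upper post (count-absent (suc j) post (λ h → after (suc h) (s≤s z≤n)))
          | ⊔-identityʳ (1 ∸ count j post) | 0∸n≡0 (count j post)
          = sym (m≤n⇒m∸n≡0 (m∸n≤m 1 (count j post)))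
  maxExcess-erase-last-upper (suc β) (x ∷ s) e after
    rewrite maxExcess-erase-last-upper β s e (λ h lt → after (suc h) (s≤s lt)) =
      trans (cong (_⊔ (maxExcess j s ∸ 1)) head) (sym (∸-distribʳ-⊔ 1 (excess j (x ∷ s)) (maxExcess j s)))
    where
    s′ = erase β s
    uppers : count (suc j) s ≡ suc (count (suc j) s′)
    uppers = sym (count-erase-same (suc j) β s sj≢0 e)
    lowers : count j s′ ≡ count j s
    lowers = count-erase-other j β s j≢0 (λ e′ → j≢sj (trans (sym e′) e))
    head : excess j (x ∷ s′) ≡ excess j (x ∷ s) ∸ 1
    head rewrite uppers | lowers | +-suc (bit (x ≡ᵇ suc j)) (count (suc j) s′)
               | ∸-+-assoc (suc (bit (x ≡ᵇ suc j) + count (suc j) s′)) (bit (x ≡ᵇ j) + count j s) 1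
               | +-comm (bit (x ≡ᵇ j) + count j s) 1 = refl

  -- Wrapping step: a j at α and a j+1 at β > α, with no j+1 outside (α, β],
  -- in a word with as many j's as (j+1)'s.  Erasing both lowers maxExcess by
  -- exactly one: the suffix after α has positive excess, and β holds its last j+1.
  maxExcess-erase-wrapped : ∀ α β u → α < β → letterAt u α ≡ j → letterAt u β ≡ suc j
     → NoUpperBefore α u → (∀ h → β < h → letterAt u h ≢ suc j)
     → count j u ≡ count (suc j) u
     → suc (maxExcess j (erase β (erase α u))) ≡ maxExcess j u
  maxExcess-erase-wrapped α β u α<β eα eβ before after balanced =
    trans (cong suc (trans erased-suffix (maxExcess-erase-last-upper b t eβ′ after′)))
      (trans (+-comm 1 (maxExcess j t ∸ 1)) (trans (m∸n+n≡m positive) (sym (maxExcess-drop γ u nu))))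
    where
    γ = suc α
    b = β ∸ γ
    β≡γ+b : γ + b ≡ β
    β≡γ+b = m+[n∸m]≡n α<β
    t = drop γ u
    u′ = erase β (erase α u)
    nu : NoUpperBefore γ u
    nu = no-upper-through α u eα before
    eβ′ : letterAt t b ≡ suc j
    eβ′ = trans (letterAt-drop γ u b) (trans (cong (letterAt u) β≡γ+b) eβ)
    after′ : ∀ h → b < h → letterAt t h ≢ suc j
    after′ h b<h e = after (γ + h) (subst (_< γ + h) β≡γ+b (+-monoʳ-< γ b<h)) (trans (sym (letterAt-drop γ u h)) e)
    nu′ : NoUpperBefore γ u′
    nu′ h h<γ rewrite letterAt-erase β (erase α u) h | letterAt-erase α u h
                    | ≢⇒≡ᵇ-false β h (λ e → <⇒≱ α<β (subst (_≤ α) (sym e) (≤-pred h<γ))) with α ≡ᵇ h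
    ... | true = λ ()
    ... | false = nu h h<γ
    drop-u′ : drop γ u′ ≡ erase b t
    drop-u′ = trans (cong (λ z → drop γ (erase z (erase α u))) (sym β≡γ+b))
                (trans (drop-erase-after γ b (erase α u)) (cong (erase b) (drop-erase-before α γ u ≤-refl)))
    erased-suffix : maxExcess j u′ ≡ maxExcess j (erase b t)
    erased-suffix = trans (maxExcess-drop γ u′ nu′) (cong (maxExcess j) drop-u′)
    lowers : suc (count j t) ≤ count j u
    lowers = subst (_≤ count j u) (trans (cong (count j) (drop-at-letter α u j eα j≢0)) (cong (_+ count j t) (bit-≡ᵇ-refl j)))
                   (count-drop-≤ j α u)
    positive : 1 ≤ maxExcess j t
    positive = ≤-trans (m<n⇒0<n∸m (subst (count j t <_) (trans balanced (sym (count-drop-absent (suc j) γ u nu))) lowers))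
                       (excess≤maxExcess t)

-- The subword on {j, j+1} has the same
-- maxExcess as w; each deletion of a pair (j+1) j keeps it; and on a reduced
-- word j^r (j+1)^s it is s, the number of (j+1)'s left.
module Depth (j : ℕ) (j≢0 : j ≢ 0) where
  open MaxExcess j j≢0

  TwoLetter : List ℕ → Set
  TwoLetter = All (λ x → x ≡ j ⊎ x ≡ suc j)

  Reduced : List ℕ → Set
  Reduced [] = ⊤
  Reduced (x ∷ []) = ⊤
  Reduced (x ∷ y ∷ xs) = ((x ≡ᵇ suc j) ∧ (y ≡ᵇ j)) ≡ false × Reduced (y ∷ xs)

  Reduced-tail : ∀ x u → Reduced (x ∷ u) → Reduced u
  Reduced-tail x [] _ = tt
  Reduced-tail x (y ∷ u) (_ , p) = p

  del : List ℕ → List ℕ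
  del = deletePair j

  record Deletion (u v : List ℕ) : Set where
    field
      shorter : length u ≡ 2 + length v
      same-maxExcess : maxExcess j v ≡ maxExcess j u
      one-lower : count j u ≡ suc (count j v)
      one-upper : count (suc j) u ≡ suc (count (suc j) v)

  pair-deletion : ∀ xs → Deletion (suc j ∷ j ∷ xs) xs
  pair-deletion xs = record
    { shorter = refl
    ; same-maxExcess = sym (maxExcess-cancel-head 0 (j ∷ xs) refl (λ _ ()))
    ; one-lower = lower
    ; one-upper = upper
    }
    where
    lower : count j (suc j ∷ j ∷ xs) ≡ suc (count j xs)
    lower rewrite sj≡ᵇj | ≡ᵇ-refl j = refl
    upper : count (suc j) (suc j ∷ j ∷ xs) ≡ suc (count (suc j) xs)
    upper rewrite ≡ᵇ-refl (suc j) | ≢⇒≡ᵇ-false j (suc j) j≢sj = refl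

  deletion-cons : ∀ x u v → Deletion u v → Deletion (x ∷ u) (x ∷ v)
  deletion-cons x u v d = record
    { shorter = cong suc shorter
    ; same-maxExcess = cong₂ _⊔_ (sym (cong₂ _∸_ upper lower)) same-maxExcess
    ; one-lower = lower
    ; one-upper = upper
    }
    where
    open Deletion d
    lower : count j (x ∷ u) ≡ suc (count j (x ∷ v))
    lower = trans (cong (bit (x ≡ᵇ j) +_) one-lower) (+-suc _ _)
    upper : count (suc j) (x ∷ u) ≡ suc (count (suc j) (x ∷ v))
    upper = trans (cong (bit (x ≡ᵇ suc j) +_) one-upper) (+-suc _ _)

  del-cases : ∀ u → (Reduced u × del u ≡ u) ⊎ Deletion u (del u)
  del-cases [] = inj₁ (tt , refl)
  del-cases (x ∷ []) = inj₁ (tt , refl)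
  del-cases (x ∷ y ∷ xs) = step _ refl (del-cases (y ∷ xs))
    where
    step : ∀ b → ((x ≡ᵇ suc j) ∧ (y ≡ᵇ j)) ≡ b
      → (Reduced (y ∷ xs) × del (y ∷ xs) ≡ y ∷ xs) ⊎ Deletion (y ∷ xs) (del (y ∷ xs))
      → (Reduced (x ∷ y ∷ xs) × del (x ∷ y ∷ xs) ≡ x ∷ y ∷ xs) ⊎ Deletion (x ∷ y ∷ xs) (del (x ∷ y ∷ xs))
    step true test _ with ≡ᵇ-sound x (suc j) (∧-conicalˡ _ _ test) | ≡ᵇ-sound y j (∧-conicalʳ _ _ test)
    ... | refl | refl rewrite test = inj₂ (pair-deletion xs)
    step false test (inj₁ (reduced , fixed)) rewrite test = inj₁ ((refl , reduced) , cong (x ∷_) fixed)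
    step false test (inj₂ d) rewrite test = inj₂ (deletion-cons x (y ∷ xs) (del (y ∷ xs)) d)

  TwoLetter-del : ∀ u → TwoLetter u → TwoLetter (del u)
  TwoLetter-del [] a = a
  TwoLetter-del (x ∷ []) a = a
  TwoLetter-del (x ∷ y ∷ xs) (px ∷ py ∷ a) = step _ (TwoLetter-del (y ∷ xs) (py ∷ a))
    where
    step : ∀ b → TwoLetter (del (y ∷ xs)) → TwoLetter (if b then xs else x ∷ del (y ∷ xs))
    step true _ = a
    step false r = px ∷ r

  reduced-no-lower : ∀ r → Reduced (suc j ∷ r) → TwoLetter r → count j r ≡ 0
  reduced-no-lower [] _ _ = refl
  reduced-no-lower (y ∷ r) (e , _) (inj₁ refl ∷ a) with trans (sym (cong₂ _∧_ (≡ᵇ-refl (suc y)) (≡ᵇ-refl y))) e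
  ... | ()
  reduced-no-lower (y ∷ r) (e , reduced) (inj₂ refl ∷ a) rewrite sj≡ᵇj = reduced-no-lower r reduced a

  maxExcess-reduced : ∀ u → Reduced u → TwoLetter u → maxExcess j u ≡ count (suc j) u
  maxExcess-reduced [] _ _ = refl
  maxExcess-reduced (x ∷ r) reduced (inj₁ refl ∷ a) =
    trans (maxExcess-cons-skip x r j≢sj)
      (trans (maxExcess-reduced r (Reduced-tail x r reduced) a)
             (cong (_+ count (suc j) r) (sym (cong bit (≢⇒≡ᵇ-false j (suc j) j≢sj)))))
  maxExcess-reduced (x ∷ r) reduced (inj₂ refl ∷ a)
    rewrite ≡ᵇ-refl (suc j) | sj≡ᵇj | reduced-no-lower r reduced a | maxExcess-reduced r (Reduced-tail x r reduced) a =
    m≥n⇒m⊔n≡m (n≤1+n (count (suc j) r))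

  iterDelete-fixed : ∀ f u → del u ≡ u → iterDelete j f u ≡ u
  iterDelete-fixed zero u e = refl
  iterDelete-fixed (suc f) u e rewrite e = iterDelete-fixed f u e

  iterDelete-maxExcess : ∀ f u → length u ≤ f → TwoLetter u → count (suc j) (iterDelete j f u) ≡ maxExcess j u
  iterDelete-maxExcess zero [] _ _ = refl
  iterDelete-maxExcess (suc f) u fuel a with del-cases u
  ... | inj₁ (reduced , fixed) rewrite fixed | iterDelete-fixed f u fixed = sym (maxExcess-reduced u reduced a)
  ... | inj₂ d = trans (iterDelete-maxExcess f (del u) fuel′ (TwoLetter-del u a)) same-maxExcess
    where
    open Deletion d
    fuel′ : length (del u) ≤ f
    fuel′ = ≤-pred (≤-trans (n≤1+n _) (subst (_≤ suc f) shorter fuel))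

  sub : List ℕ → List ℕ
  sub = subwordJ j

  TwoLetter-subword : ∀ w → TwoLetter (sub w)
  TwoLetter-subword [] = []
  TwoLetter-subword (x ∷ w) with x ≡ᵇ j in e1 | x ≡ᵇ suc j in e2
  ... | true | _ = inj₁ (≡ᵇ-sound x j e1) ∷ TwoLetter-subword w
  ... | false | true = inj₂ (≡ᵇ-sound x (suc j) e2) ∷ TwoLetter-subword w
  ... | false | false = TwoLetter-subword w

  count-subword : ∀ c w → (c ≡ j ⊎ c ≡ suc j) → count c (sub w) ≡ count c w
  count-subword c [] _ = refl
  count-subword c (x ∷ w) cj with x ≡ᵇ j in e1 | x ≡ᵇ suc j in e2
  ... | true | _ = cong (bit (x ≡ᵇ c) +_) (count-subword c w cj)
  ... | false | true = cong (bit (x ≡ᵇ c) +_) (count-subword c w cj)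
  ... | false | false = trans (count-subword c w cj) (sym (cong (_+ count c w) (cong bit (other cj))))
    where
    other : (c ≡ j ⊎ c ≡ suc j) → (x ≡ᵇ c) ≡ false
    other (inj₁ refl) = e1
    other (inj₂ refl) = e2

  subword-keep : ∀ x w → ((x ≡ᵇ j) ∨ (x ≡ᵇ suc j)) ≡ true → sub (x ∷ w) ≡ x ∷ sub w
  subword-keep x w e with (x ≡ᵇ j) ∨ (x ≡ᵇ suc j)
  ... | true = refl

  subword-skip : ∀ x w → ((x ≡ᵇ j) ∨ (x ≡ᵇ suc j)) ≡ false → sub (x ∷ w) ≡ sub w
  subword-skip x w e with (x ≡ᵇ j) ∨ (x ≡ᵇ suc j)
  ... | false = refl

  maxExcess-subword : ∀ w → maxExcess j (sub w) ≡ maxExcess j w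
  maxExcess-subword [] = refl
  maxExcess-subword (x ∷ w) = step _ refl
    where
    step : ∀ b → ((x ≡ᵇ j) ∨ (x ≡ᵇ suc j)) ≡ b → maxExcess j (sub (x ∷ w)) ≡ maxExcess j (x ∷ w)
    step true e rewrite subword-keep x w e =
      cong₂ _⊔_ (cong₂ _∸_ (cong (bit (x ≡ᵇ suc j) +_) (count-subword (suc j) w (inj₂ refl)))
                           (cong (bit (x ≡ᵇ j) +_) (count-subword j w (inj₁ refl)))) (maxExcess-subword w)
    step false e rewrite subword-skip x w e = trans (maxExcess-subword w) (sym (maxExcess-cons-skip x w x≢sj))
      where
      x≢sj : x ≢ suc j
      x≢sj refl = true≢false (trans (sym (≡ᵇ-refl (suc j))) (∨-conicalʳ (suc j ≡ᵇ j) _ e))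

  depth≡maxExcess : ∀ w → depth j w ≡ maxExcess j w
  depth≡maxExcess w =
    trans (occ≡count (suc j) (reducedJ j w))
      (trans (iterDelete-maxExcess (length (sub w)) (sub w) ≤-refl (TwoLetter-subword w)) (maxExcess-subword w))

oneTo : ℕ → List ℕ
oneTo m = map suc (upTo m)

sum-oneTo-suc : ∀ (f : ℕ → ℕ) m → sum (map f (oneTo (suc m))) ≡ sum (map f (oneTo m)) + f (suc m)
sum-oneTo-suc f m = begin
  sum (map f (oneTo (suc m)))                      ≡⟨ cong (λ l → sum (map f (map suc l))) (sym (upTo-∷ʳ m)) ⟩
  sum (map f (map suc (upTo m ++ m ∷ [])))         ≡⟨ cong (λ l → sum (map f l)) (map-++ suc (upTo m) (m ∷ [])) ⟩
  sum (map f (oneTo m ++ suc m ∷ []))              ≡⟨ cong sum (map-++ f (oneTo m) (suc m ∷ [])) ⟩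
  sum (map f (oneTo m) ++ f (suc m) ∷ [])          ≡⟨ sum-++ (map f (oneTo m)) (f (suc m) ∷ []) ⟩
  sum (map f (oneTo m)) + (f (suc m) + 0)          ≡⟨ cong (sum (map f (oneTo m)) +_) (+-identityʳ (f (suc m))) ⟩
  sum (map f (oneTo m)) + f (suc m)                ∎
  where open ≡-Reasoning

sum-oneTo-cong : ∀ m (f g : ℕ → ℕ) → (∀ i → i < m → f (suc i) ≡ g (suc i)) → sum (map f (oneTo m)) ≡ sum (map g (oneTo m))
sum-oneTo-cong zero f g _ = refl
sum-oneTo-cong (suc m) f g e rewrite sum-oneTo-suc f m | sum-oneTo-suc g m =
  cong₂ _+_ (sum-oneTo-cong m f g (λ i lt → e i (<-trans lt (n<1+n m)))) (e m (n<1+n m))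

sum-oneTo-zero : ∀ m (f : ℕ → ℕ) → (∀ i → i < m → f (suc i) ≡ 0) → sum (map f (oneTo m)) ≡ 0
sum-oneTo-zero m f e = trans (sum-oneTo-cong m f (λ _ → 0) e) (zeros m)
  where
  zeros : ∀ m → sum (map (λ _ → 0) (oneTo m)) ≡ 0
  zeros zero = refl
  zeros (suc m) rewrite sum-oneTo-suc (λ _ → 0) m = trans (+-identityʳ _) (zeros m)

sum-+-distrib : ∀ (l : List ℕ) (a b c : ℕ → ℕ)
  → sum (map (λ j → (a j + b j) * c j) l) ≡ sum (map (λ j → a j * c j) l) + sum (map (λ j → b j * c j) l)
sum-+-distrib [] a b c = refl
sum-+-distrib (x ∷ l) a b c rewrite sum-+-distrib l a b c | *-distribʳ-+ (c x) (a x) (b x) =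
  +-assoc-swap (a x * c x) (b x * c x) _ _
  where
  +-assoc-swap : ∀ p q r s → (p + q) + (r + s) ≡ (p + r) + (q + s)
  +-assoc-swap p q r s rewrite +-assoc p q (r + s) | sym (+-assoc q r s) | +-comm q r | +-assoc r q s | sym (+-assoc p r (q + s)) = refl

-- With F i = position of the value i+1,
-- rev (π⁻¹) = F (m-1), …, F 0, and its descent at position p is an ascent
-- F (j-1) < F j of π⁻¹; so the charge is Σ_j [pos j < pos (j+1)] (m - j).

revTab : (ℕ → ℕ) → ℕ → List ℕ
revTab F zero = []
revTab F (suc m) = F m ∷ revTab F m

reverse-map-upTo : ∀ F m → reverse (map F (upTo m)) ≡ revTab F m
reverse-map-upTo F zero = refl
reverse-map-upTo F (suc m) =
  trans (cong (λ l → reverse (map F l)) (sym (upTo-∷ʳ m)))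
    (trans (cong reverse (map-++ F (upTo m) (m ∷ [])))
      (trans (reverse-++ (map F (upTo m)) (F m ∷ [])) (cong (F m ∷_) (reverse-map-upTo F m))))

ascentSum : (ℕ → ℕ) → ℕ → ℕ → ℕ
ascentSum F p zero = 0
ascentSum F p (suc m) = bit (F m <ᵇ F (suc m)) * p + ascentSum F (suc p) m

if-bit : ∀ b p → (if b then p else 0) ≡ bit b * p
if-bit true p = sym (+-identityʳ p)
if-bit false p = refl

maj-revTab : ∀ F p m → majFrom p (revTab F (suc m)) ≡ ascentSum F p m
maj-revTab F p zero = refl
maj-revTab F p (suc m) = cong₂ _+_ (if-bit (F m <ᵇ F (suc m)) p) (maj-revTab F (suc p) m)

ascentSum-oneTo : ∀ F p m → ascentSum F p m ≡ sum (map (λ j → bit (F (pred j) <ᵇ F j) * (p + m ∸ j)) (oneTo m))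
ascentSum-oneTo F p zero = refl
ascentSum-oneTo F p (suc m) rewrite sum-oneTo-suc (λ j → bit (F (pred j) <ᵇ F j) * (p + suc m ∸ j)) m
  | +-suc p m | m+n∸n≡m p m =
  trans (+-comm _ (ascentSum F (suc p) m)) (cong (_+ bit (F m <ᵇ F (suc m)) * p) (ascentSum-oneTo F (suc p) m))

chargePerm-formula : ∀ σ m → length σ ≡ m →
  chargePerm σ ≡ sum (map (λ j → bit (posOf j σ <ᵇ posOf (suc j) σ) * (m ∸ j)) (oneTo (m ∸ 1)))
chargePerm-formula σ zero e rewrite e = refl
chargePerm-formula σ (suc m) e =
  trans (cong (majFrom 1) (trans (cong (λ z → reverse (map F (upTo z))) e) (reverse-map-upTo F (suc m))))
    (trans (maj-revTab F 1 m) (trans (ascentSum-oneTo F 1 m) (sum-oneTo-cong m _ _ (λ i _ → refl))))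
  where
  F : ℕ → ℕ
  F i = posOf (suc i) σ

filterᵇ : (ℕ → Bool) → List ℕ → List ℕ
filterᵇ b l = filter (λ p → T? (b p)) l

T⇒≡true : ∀ {b} → T b → b ≡ true
T⇒≡true {true} _ = refl

≡true⇒T : ∀ {b} → b ≡ true → T b
≡true⇒T refl = tt

filterᵇ-cases : ∀ b x l → (b x ≡ true × filterᵇ b (x ∷ l) ≡ x ∷ filterᵇ b l)
                         ⊎ (b x ≡ false × filterᵇ b (x ∷ l) ≡ filterᵇ b l)
filterᵇ-cases b x l with b x
... | true = inj₁ (refl , refl)
... | false = inj₂ (refl , refl)

filterᵇ-false : ∀ l → filterᵇ (λ _ → false) l ≡ []
filterᵇ-false [] = refl
filterᵇ-false (x ∷ l) = filterᵇ-false l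

range : ℕ → ℕ → List ℕ
range o zero = []
range o (suc d) = o ∷ range (suc o) d

upTo≡range : ∀ n → upTo n ≡ range 0 n
upTo≡range n = shifted id 0 n (λ i → refl)
  where
  shifted : ∀ (f : ℕ → ℕ) o d → (∀ i → f i ≡ o + i) → applyUpTo f d ≡ range o d
  shifted f o zero _ = refl
  shifted f o (suc d) e =
    cong₂ _∷_ (trans (e 0) (+-identityʳ o)) (shifted (λ i → f (suc i)) (suc o) d (λ i → trans (e (suc i)) (+-suc o i)))

filterᵇ-cong-range : ∀ b₁ b₂ o d → (∀ p → o ≤ p → p < o + d → b₁ p ≡ b₂ p)
  → filterᵇ b₁ (range o d) ≡ filterᵇ b₂ (range o d)
filterᵇ-cong-range b₁ b₂ o zero e = refl
filterᵇ-cong-range b₁ b₂ o (suc d) e with filterᵇ-cases b₁ o (range (suc o) d) | filterᵇ-cases b₂ o (range (suc o) d)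
... | inj₁ (_ , e₁) | inj₁ (_ , e₂) rewrite e₁ | e₂ = cong (o ∷_) (filterᵇ-cong-range b₁ b₂ (suc o) d e′)
  where
  e′ : ∀ p → suc o ≤ p → p < suc o + d → b₁ p ≡ b₂ p
  e′ p a b = e p (<⇒≤ a) (subst (p <_) (sym (+-suc o d)) b)
... | inj₂ (_ , e₁) | inj₂ (_ , e₂) rewrite e₁ | e₂ = filterᵇ-cong-range b₁ b₂ (suc o) d e′
  where
  e′ : ∀ p → suc o ≤ p → p < suc o + d → b₁ p ≡ b₂ p
  e′ p a b = e p (<⇒≤ a) (subst (p <_) (sym (+-suc o d)) b)
... | inj₁ (t , _) | inj₂ (f , _) = ⊥-elim (true≢false (trans (sym t) (trans (e o ≤-refl (m<m+n o (s≤s z≤n))) f)))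
... | inj₂ (f , _) | inj₁ (t , _) = ⊥-elim (true≢false (trans (sym t) (trans (sym (e o ≤-refl (m<m+n o (s≤s z≤n)))) f)))

length-filterᵇ-insert : ∀ o d q (M : ℕ → Bool) → o ≤ q → q < o + d → M q ≡ false →
  length (filterᵇ (λ p → (q ≡ᵇ p) ∨ M p) (range o d)) ≡ suc (length (filterᵇ M (range o d)))
length-filterᵇ-insert o zero q M le lt _ = ⊥-elim (<⇒≱ lt (subst (_≤ q) (sym (+-identityʳ o)) le))
length-filterᵇ-insert o (suc d) q M le lt Mq with o ≟ q
... | yes refl rewrite ≡ᵇ-refl o | Mq =
  cong suc (cong length (filterᵇ-cong-range _ M (suc o) d (λ p a b → cong (_∨ M p) (≢⇒≡ᵇ-false o p (λ e → <⇒≢ a e)))))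
... | no o≢q with filterᵇ-cases M o (range (suc o) d)
...   | inj₁ (t , e) rewrite ≢⇒≡ᵇ-false q o (λ e → o≢q (sym e)) | t | e =
        cong suc (length-filterᵇ-insert (suc o) d q M (≤∧≢⇒< le o≢q) (subst (q <_) (+-suc o d) lt) Mq)
...   | inj₂ (f , e) rewrite ≢⇒≡ᵇ-false q o (λ e → o≢q (sym e)) | f | e =
        length-filterᵇ-insert (suc o) d q M (≤∧≢⇒< le o≢q) (subst (q <_) (+-suc o d) lt) Mq

posOf-member : ∀ i xs → i ∈ xs → Σ ℕ λ r → posOf i xs ≡ suc r
posOf-member i (x ∷ xs) (here refl) rewrite ≡ᵇ-refl x = 0 , refl
posOf-member i (x ∷ xs) (there m) with x ≡ᵇ i
... | true = 0 , refl
... | false with posOf-member i xs m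
... | r , e rewrite e = suc r , refl

posOf-skip : ∀ i x xs → x ≢ i → i ∈ xs → posOf i (x ∷ xs) ≡ suc (posOf i xs)
posOf-skip i x xs ne m with posOf-member i xs m
... | r , e rewrite ≢⇒≡ᵇ-false x i ne | e = refl

tail∈ : ∀ {x q : ℕ} {l : List ℕ} → x ≢ q → q ∈ x ∷ l → q ∈ l
tail∈ ne (here e) = ⊥-elim (ne (sym e))
tail∈ ne (there m) = m

posOf-order : ∀ (g : ℕ → ℕ) a b qa qb (l : List ℕ) → AllPairs _<_ l → qa ∈ l → qb ∈ l → g qa ≡ a → g qb ≡ b → a ≢ b
   → (∀ x → x ∈ l → g x ≡ a → x ≡ qa) → (∀ x → x ∈ l → g x ≡ b → x ≡ qb)
   → (posOf a (map g l) <ᵇ posOf b (map g l)) ≡ (qa <ᵇ qb)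
posOf-order g a b qa qb (x ∷ l) (x<l ∷ sorted) ma mb ga gb a≢b ua ub with x ≟ qa | x ≟ qb
... | yes refl | yes refl = ⊥-elim (a≢b (trans (sym ga) gb))
... | yes refl | no x≢qb with posOf-member b (map g l) (subst (_∈ map g l) gb (∈-map⁺ g (tail∈ x≢qb mb)))
...   | r , e rewrite ga | ≡ᵇ-refl a | ≢⇒≡ᵇ-false a b a≢b | e | <⇒<ᵇ-true x qb (lookup x<l (tail∈ x≢qb mb)) = refl
posOf-order g a b qa qb (x ∷ l) (x<l ∷ sorted) ma mb ga gb a≢b ua ub | no x≢qa | yes refl
  with posOf-member a (map g l) (subst (_∈ map g l) ga (∈-map⁺ g (tail∈ x≢qa ma)))
... | r , e rewrite gb | ≡ᵇ-refl b | ≢⇒≡ᵇ-false b a (λ e → a≢b (sym e)) | e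
                  | ≥⇒<ᵇ-false qa x (<⇒≤ (lookup x<l (tail∈ x≢qa ma))) = refl
posOf-order g a b qa qb (x ∷ l) (x<l ∷ sorted) ma mb ga gb a≢b ua ub | no x≢qa | no x≢qb =
  trans (cong₂ _<ᵇ_ (posOf-skip a (g x) (map g l) gx≢a (subst (_∈ map g l) ga (∈-map⁺ g ma′)))
                    (posOf-skip b (g x) (map g l) gx≢b (subst (_∈ map g l) gb (∈-map⁺ g mb′))))
        (posOf-order g a b qa qb l sorted ma′ mb′ ga gb a≢b (λ y m → ua y (there m)) (λ y m → ub y (there m)))
  where
  ma′ = tail∈ x≢qa ma
  mb′ = tail∈ x≢qb mb
  gx≢a : g x ≢ a
  gx≢a e = x≢qa (ua x (here refl) e)
  gx≢b : g x ≢ b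
  gx≢b e = x≢qb (ub x (here refl) e)

avail≡blanked : ∀ w U c p → c ≢ 0 → avail w U c p ≡ (letterAt (blanked w U) p ≡ᵇ c)
avail≡blanked w U c p c≢0 rewrite letterAt-blanked w U p with p <? length w
... | yes lt rewrite <⇒<ᵇ-true p (length w) lt with memb p U
...   | true rewrite ≢⇒≡ᵇ-false 0 c (λ e → c≢0 (sym e)) with letterAt w p ≡ᵇ c
...     | true = refl
...     | false = refl
avail≡blanked w U c p c≢0 | yes lt | false with letterAt w p ≡ᵇ c
...     | true = refl
...     | false = refl
avail≡blanked w U c p c≢0 | no ge rewrite ≥⇒<ᵇ-false p (length w) (≮⇒≥ ge) | letterAt-out w p (≮⇒≥ ge) with memb p U
... | true rewrite ≢⇒≡ᵇ-false 0 c (λ e → c≢0 (sym e)) = refl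
... | false rewrite ≢⇒≡ᵇ-false 0 c (λ e → c≢0 (sym e)) = refl

avail-out : ∀ w U c p → length w ≤ p → avail w U c p ≡ false
avail-out w U c p le rewrite ≥⇒<ᵇ-false p (length w) le = refl

avail⇒in-word : ∀ w U c p → avail w U c p ≡ true → p < length w
avail⇒in-word w U c p a with p <? length w
... | yes lt = lt
... | no ge = ⊥-elim (true≢false (trans (sym a) (avail-out w U c p (≮⇒≥ ge))))

just-injective : ∀ {x y : ℕ} → just x ≡ just y → x ≡ y
just-injective refl = refl

just≢nothing : ∀ {x : ℕ} → just x ≢ nothing
just≢nothing ()

fromMaybe-just : ∀ {m : Maybe ℕ} {q} → m ≡ just q → fromMaybe 0 m ≡ q
fromMaybe-just refl = refl

module Search (w U : List ℕ) (c : ℕ) where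
  av = avail w U c

  SearchHit : ℕ → ℕ → ℕ → Set
  SearchHit lo hi q = lo ≤ q × q < hi × av q ≡ true × (∀ h → q < h → h < hi → av h ≡ false)

  search-step : ∀ lo h → (lo ≤ h × av h ≡ true × searchBetween w U c lo (suc h) ≡ just h)
                   ⊎ ((h < lo ⊎ av h ≡ false) × searchBetween w U c lo (suc h) ≡ searchBetween w U c lo h)
  search-step lo h with h <ᵇ lo in e1 | av h in e2
  ... | true | _ = inj₂ (inj₁ (<ᵇ⇒< h lo (≡true⇒T e1)) , refl)
  ... | false | false = inj₂ (inj₂ refl , refl)
  ... | false | true = inj₁ (≮⇒≥ (λ lt → subst T e1 (<⇒<ᵇ lt)) , refl , refl)

  skipped-unavailable : ∀ {lo h} → (h < lo ⊎ av h ≡ false) → lo ≤ h → av h ≡ false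
  skipped-unavailable (inj₂ f) _ = f
  skipped-unavailable (inj₁ hlo) lh = ⊥-elim (<⇒≱ hlo lh)

  search-hit : ∀ lo hi q → searchBetween w U c lo hi ≡ just q → SearchHit lo hi q
  search-hit lo zero q ()
  search-hit lo (suc h) q e with search-step lo h
  ... | inj₁ (le , a , e′) =
    subst (SearchHit lo (suc h)) (just-injective (trans (sym e′) e)) (le , ≤-refl , a , λ h′ p r → ⊥-elim (<⇒≱ p (≤-pred r)))
  ... | inj₂ (skipped , e′) with search-hit lo h q (trans (sym e′) e)
  ... | (lo≤q , q<h , a , above) = lo≤q , ≤-trans q<h (n≤1+n h) , a , above′
    where
    above′ : ∀ h′ → q < h′ → h′ < suc h → av h′ ≡ false
    above′ h′ qh hs with m≤n⇒m<n∨m≡n (≤-pred hs)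
    ... | inj₁ lt = above h′ qh lt
    ... | inj₂ refl = skipped-unavailable skipped (≤-trans lo≤q (<⇒≤ qh))

  search-miss : ∀ lo hi → searchBetween w U c lo hi ≡ nothing → ∀ h → lo ≤ h → h < hi → av h ≡ false
  search-miss lo zero e h _ ()
  search-miss lo (suc hi) e h lh hs with search-step lo hi
  ... | inj₁ (_ , _ , e′) = ⊥-elim (just≢nothing (trans (sym e′) e))
  ... | inj₂ (skipped , e′) with m≤n⇒m<n∨m≡n (≤-pred hs)
  ... | inj₁ lt = search-miss lo hi (trans (sym e′) e) h lh lt
  ... | inj₂ refl = skipped-unavailable skipped lh

  search-succeeds : ∀ lo hi h → lo ≤ h → h < hi → av h ≡ true → Σ ℕ λ q → searchBetween w U c lo hi ≡ just q
  search-succeeds lo hi h lh hs a with searchBetween w U c lo hi in e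
  ... | just q = q , refl
  ... | nothing = ⊥-elim (true≢false (trans (sym a) (search-miss lo hi e h lh hs)))

  search-hit-available : ∀ {lo hi q} → searchBetween w U c lo hi ≡ just q → av q ≡ true
  search-hit-available {lo} {hi} {q} e = proj₁ (proj₂ (proj₂ (search-hit lo hi q e)))

  NextHit : ℕ → ℕ → Set
  NextHit p q = av q ≡ true × ((q < p × (∀ h → q < h → h < p → av h ≡ false))
                           ⊎ (p < q × (∀ h → h < p → av h ≡ false) × (∀ h → q < h → av h ≡ false)))

  nextPos-cases : ∀ p → (Σ ℕ λ q → searchBetween w U c 0 p ≡ just q × nextPos w U c p ≡ just q)
                 ⊎ (searchBetween w U c 0 p ≡ nothing × nextPos w U c p ≡ searchBetween w U c (suc p) (length w))
  nextPos-cases p with searchBetween w U c 0 p in e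
  ... | just q = inj₁ (q , refl , refl)
  ... | nothing = inj₂ (refl , refl)

  nextPos-hit : ∀ p q → nextPos w U c p ≡ just q → NextHit p q
  nextPos-hit p q e with nextPos-cases p
  ... | inj₁ (q′ , e1 , e2) with search-hit 0 p q (trans e1 (trans (sym e2) e))
  ... | (_ , q<p , a , between) = a , inj₁ (q<p , between)
  nextPos-hit p q e | inj₂ (e1 , e2) with search-hit (suc p) (length w) q (trans (sym e2) e)
  ... | (p<q , _ , a , above) = a , inj₂ (p<q , (λ h h<p → search-miss 0 p e1 h z≤n h<p) , after)
    where
    after : ∀ h → q < h → av h ≡ false
    after h q<h with h <? length w
    ... | yes hL = above h q<h hL
    ... | no hL = avail-out w U c h (≮⇒≥ hL)

  nextPos-miss : ∀ p → nextPos w U c p ≡ nothing → ∀ h → h ≢ p → av h ≡ false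
  nextPos-miss p e h h≢p with nextPos-cases p
  ... | inj₁ (q′ , e1 , e2) = ⊥-elim (just≢nothing (trans (sym e2) e))
  ... | inj₂ (e1 , e2) with h <? p
  ... | yes lt = search-miss 0 p e1 h z≤n lt
  ... | no ge with h <? length w
  ... | yes hL = search-miss (suc p) (length w) (trans (sym e2) e) h (≤∧≢⇒< (≮⇒≥ ge) (λ e′ → h≢p (sym e′))) hL
  ... | no hL = avail-out w U c h (≮⇒≥ hL)

  nextPos-succeeds : ∀ p h → h ≢ p → av h ≡ true → Σ ℕ λ q → nextPos w U c p ≡ just q
  nextPos-succeeds p h h≢p a with nextPos w U c p in e
  ... | just q = q , refl
  ... | nothing = ⊥-elim (true≢false (trans (sym a) (nextPos-miss p e h h≢p)))

searchBetween-cong : ∀ w U₁ U₂ c → (∀ h → avail w U₁ c h ≡ avail w U₂ c h)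
  → ∀ lo hi → searchBetween w U₁ c lo hi ≡ searchBetween w U₂ c lo hi
searchBetween-cong w U₁ U₂ c eq lo zero = refl
searchBetween-cong w U₁ U₂ c eq lo (suc h) rewrite eq h | searchBetween-cong w U₁ U₂ c eq lo h = refl

nextPos-cong : ∀ w U₁ U₂ c → (∀ h → avail w U₁ c h ≡ avail w U₂ c h) → ∀ p → nextPos w U₁ c p ≡ nextPos w U₂ c p
nextPos-cong w U₁ U₂ c eq p with searchBetween w U₁ c 0 p | searchBetween w U₂ c 0 p | searchBetween-cong w U₁ U₂ c eq 0 p
... | just q | .(just q) | refl = refl
... | nothing | .nothing | refl = searchBetween-cong w U₁ U₂ c eq (suc p) (length w)

below-k : ∀ k i → i < k ∸ 1 → suc (suc i) ≤ k
below-k zero i lt = ⊥-elim (<⇒≱ lt z≤n)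
below-k (suc k′) i lt = s≤s lt

module Round (k : ℕ) (w : List ℕ) (letters : ∀ h → h < length w → 1 ≤ letterAt w h × letterAt w h ≤ k)
             (U : List ℕ) (f : ℕ) (balanced : ∀ c → 1 ≤ c → c ≤ k → count c (blanked w U) ≡ suc f) where

  L = length w
  u₀ = blanked w U

  nonzero : ∀ {c} → 1 ≤ c → c ≢ 0
  nonzero le refl = <⇒≱ le z≤n

  blanked-≤ : ∀ h → letterAt u₀ h ≤ k
  blanked-≤ h rewrite letterAt-blanked w U h with memb h U
  ... | true = z≤n
  ... | false with h <? L
  ... | yes lt = proj₂ (letters h lt)
  ... | no ge rewrite letterAt-out w h (≮⇒≥ ge) = z≤n

  available : ∀ c → 1 ≤ c → c ≤ k → Σ ℕ λ h → avail w U c h ≡ true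
  available c c1 ck with count-positive c u₀ (subst (1 ≤_) (sym (balanced c c1 ck)) (s≤s z≤n))
  ... | h , e = h , trans (avail≡blanked w U c h (nonzero c1)) (subst (λ z → (z ≡ᵇ c) ≡ true) (sym e) (≡ᵇ-refl c))

  available⇒letter : ∀ c h → 1 ≤ c → avail w U c h ≡ true → letterAt u₀ h ≡ c
  available⇒letter c h c1 a = ≡ᵇ-sound _ c (trans (sym (avail≡blanked w U c h (nonzero c1))) a)

  unavailable⇒letter : ∀ c h → 1 ≤ c → avail w U c h ≡ false → letterAt u₀ h ≢ c
  unavailable⇒letter c h c1 a e =
    true≢false (trans (sym (available⇒letter′ e)) (trans (sym (avail≡blanked w U c h (nonzero c1))) a))
    where
    available⇒letter′ : letterAt u₀ h ≡ c → (letterAt u₀ h ≡ᵇ c) ≡ true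
    available⇒letter′ refl = ≡ᵇ-refl c

  -- The position chosen for the letter i (meaningful for 1 ≤ i ≤ k).
  pick : ℕ → ℕ
  pick zero = 0
  pick (suc zero) = fromMaybe 0 (searchBetween w U 1 0 L)
  pick (suc (suc i)) = fromMaybe 0 (nextPos w U (suc (suc i)) (pick (suc i)))

  pick-first : 1 ≤ k → searchBetween w U 1 0 L ≡ just (pick 1)
  pick-first k≥1 with available 1 ≤-refl k≥1
  ... | h , a with Search.search-succeeds w U 1 0 L h z≤n (avail⇒in-word w U 1 h a) a
  ... | q , e = trans e (cong just (sym (fromMaybe-just e)))

  -- Since the letter i+2 is available elsewhere, the search from pick (i+1) succeeds.
  pick-next′ : ∀ i → suc (suc i) ≤ k → letterAt u₀ (pick (suc i)) ≡ suc i
    → nextPos w U (suc (suc i)) (pick (suc i)) ≡ just (pick (suc (suc i)))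
  pick-next′ i ik eL with available (suc (suc i)) (s≤s z≤n) ik
  ... | h , a with Search.nextPos-succeeds w U (suc (suc i)) (pick (suc i)) h h≢pick a
    where
    h≢pick : h ≢ pick (suc i)
    h≢pick e = 1+n≢n (trans (sym (available⇒letter (suc (suc i)) h (s≤s z≤n) a)) (trans (cong (letterAt u₀) e) eL))
  ... | q , e = trans e (cong just (sym (fromMaybe-just e)))

  pick-letter : ∀ i → 1 ≤ i → i ≤ k → letterAt u₀ (pick i) ≡ i
  pick-letter (suc zero) _ ik = available⇒letter 1 (pick 1) ≤-refl (Search.search-hit-available w U 1 {0} {L} (pick-first ik))
  pick-letter (suc (suc i)) _ ik = available⇒letter (suc (suc i)) (pick (suc (suc i))) (s≤s z≤n)
    (proj₁ (Search.nextPos-hit w U (suc (suc i)) (pick (suc i)) _ (pick-next′ i ik (pick-letter (suc i) (s≤s z≤n) (<⇒≤ ik)))))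

  pick-next : ∀ i → 1 ≤ i → suc i ≤ k → nextPos w U (suc i) (pick i) ≡ just (pick (suc i))
  pick-next (suc i) _ ik = pick-next′ i ik (pick-letter (suc i) (s≤s z≤n) (<⇒≤ ik))

  pick-in-word : ∀ i → 1 ≤ i → i ≤ k → letterAt w (pick i) ≡ i × memb (pick i) U ≡ false
  pick-in-word i i1 ik with trans (sym (letterAt-blanked w U (pick i))) (pick-letter i i1 ik)
  ... | e with memb (pick i) U
  ... | true = ⊥-elim (nonzero i1 (sym e))
  ... | false = e , refl

  pick-in-range : ∀ i → 1 ≤ i → i ≤ k → pick i < L
  pick-in-range i i1 ik with pick i <? L
  ... | yes lt = lt
  ... | no ge = ⊥-elim (nonzero i1 (trans (sym (proj₁ (pick-in-word i i1 ik))) (letterAt-out w (pick i) (≮⇒≥ ge))))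

  pick-injective : ∀ a b → 1 ≤ a → a ≤ k → 1 ≤ b → b ≤ k → a ≢ b → pick a ≢ pick b
  pick-injective a b a1 ak b1 bk ne e = ne (trans (sym (pick-letter a a1 ak)) (trans (cong (letterAt u₀) e) (pick-letter b b1 bk)))

  picked : ℕ → List ℕ
  picked zero = []
  picked (suc m) = pick (suc m) ∷ picked m

  afterPicks : ℕ → List ℕ
  afterPicks m = blanked w (picked m ++ U)

  afterPicks-suc : ∀ m → afterPicks (suc m) ≡ erase (pick (suc m)) (afterPicks m)
  afterPicks-suc m = mask-cons (pick (suc m)) (picked m ++ U) w

  letterAt-afterPicks : ∀ m p → letterAt (afterPicks (suc m)) p ≡ (if pick (suc m) ≡ᵇ p then 0 else letterAt (afterPicks m) p)
  letterAt-afterPicks m p = trans (cong (λ z → letterAt z p) (afterPicks-suc m)) (letterAt-erase (pick (suc m)) (afterPicks m) p)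

  afterPicks-unpicked : ∀ m i → m < i → i ≤ k → letterAt (afterPicks m) (pick i) ≡ i
  afterPicks-unpicked zero i lt ik = pick-letter i lt ik
  afterPicks-unpicked (suc m) i lt ik rewrite letterAt-afterPicks m (pick i)
    | ≢⇒≡ᵇ-false (pick (suc m)) (pick i)
                 (pick-injective (suc m) i (s≤s z≤n) (≤-trans (<⇒≤ lt) ik) (≤-trans (s≤s z≤n) lt) ik (<⇒≢ lt)) =
    afterPicks-unpicked m i (<-trans (n<1+n m) lt) ik

  afterPicks-test : ∀ m d h → m < d → m ≤ k → (letterAt (afterPicks m) h ≡ᵇ d) ≡ (letterAt u₀ h ≡ᵇ d)
  afterPicks-test zero d h _ _ = refl
  afterPicks-test (suc m) d h lt mk rewrite letterAt-afterPicks m h with pick (suc m) ≡ᵇ h in e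
  ... | true rewrite sym (≡ᵇ-sound (pick (suc m)) h e) | pick-letter (suc m) (s≤s z≤n) mk
        | ≢⇒≡ᵇ-false 0 d (λ e′ → <⇒≱ lt (subst (_≤ suc m) e′ z≤n)) = sym (≢⇒≡ᵇ-false (suc m) d (<⇒≢ lt))
  ... | false = afterPicks-test m d h (<-trans (n<1+n m) lt) (<⇒≤ mk)

  count-afterPicks-later : ∀ m c → m < c → c ≤ k → count c (afterPicks m) ≡ count c u₀
  count-afterPicks-later zero c _ _ = refl
  count-afterPicks-later (suc m) c lt ck rewrite afterPicks-suc m =
    trans (count-erase-other c (pick (suc m)) (afterPicks m) (nonzero (≤-trans (s≤s z≤n) lt))
            (λ e → <⇒≢ lt (trans (sym (afterPicks-unpicked m (suc m) ≤-refl (≤-trans (<⇒≤ lt) ck))) e)))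
          (count-afterPicks-later m c (<-trans (n<1+n m) lt) ck)

  count-afterPicks-earlier : ∀ m c → 1 ≤ c → c ≤ m → m ≤ k → suc (count c (afterPicks m)) ≡ count c u₀
  count-afterPicks-earlier zero c c1 cm _ = ⊥-elim (<⇒≱ c1 cm)
  count-afterPicks-earlier (suc m) c c1 cm mk rewrite afterPicks-suc m with m≤n⇒m<n∨m≡n cm
  ... | inj₂ refl = trans (count-erase-same c (pick c) (afterPicks m) (nonzero c1) (afterPicks-unpicked m c ≤-refl mk))
                          (count-afterPicks-later m c ≤-refl mk)
  ... | inj₁ lt = trans (cong suc (count-erase-other c (pick (suc m)) (afterPicks m) (nonzero c1)
                          (λ e → <⇒≢ lt (trans (sym e) (afterPicks-unpicked m (suc m) ≤-refl mk)))))
                        (count-afterPicks-earlier m c c1 (≤-pred lt) (<⇒≤ mk))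

  -- After the round every letter occurs f times: the invariant for the next round.
  balanced-next : ∀ c → 1 ≤ c → c ≤ k → count c (afterPicks k) ≡ f
  balanced-next c c1 ck = suc-injective (trans (count-afterPicks-earlier k c c1 ck ≤-refl) (balanced c c1 ck))

  memb-picked : ∀ m i → 1 ≤ i → i ≤ m → memb (pick i) (picked m) ≡ true
  memb-picked zero i i1 im = ⊥-elim (<⇒≱ i1 im)
  memb-picked (suc m) i i1 im with m≤n⇒m<n∨m≡n im
  ... | inj₂ refl rewrite ≡ᵇ-refl (pick i) = refl
  ... | inj₁ lt rewrite memb-picked m i i1 (≤-pred lt) = ∨-zeroʳ (pick (suc m) ≡ᵇ pick i)

  memb-picked⁻ : ∀ m x → memb x (picked m) ≡ true → Σ ℕ λ i → 1 ≤ i × i ≤ m × pick i ≡ x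
  memb-picked⁻ zero x ()
  memb-picked⁻ (suc m) x e with pick (suc m) ≡ᵇ x in e′
  ... | true = suc m , s≤s z≤n , ≤-refl , ≡ᵇ-sound _ _ e′
  ... | false with memb-picked⁻ m x e
  ... | i , i1 , im , refl = i , i1 , ≤-trans im (n≤1+n m) , refl

  pick-fresh : ∀ m → suc m ≤ k → memb (pick (suc m)) (picked m) ≡ false
  pick-fresh m mk with memb (pick (suc m)) (picked m) in e
  ... | false = refl
  ... | true with memb-picked⁻ m (pick (suc m)) e
  ... | i , i1 , im , same =
    ⊥-elim (pick-injective i (suc m) i1 (≤-trans im (<⇒≤ mk)) (s≤s z≤n) mk (λ e′ → <⇒≱ (s≤s im) (≤-reflexive (sym e′))) same)

  selected : ℕ → List ℕ
  selected m = filterᵇ (λ p → memb p (picked m)) (upTo L)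

  length-selected : ∀ m → m ≤ k → length (selected m) ≡ m
  length-selected m mk rewrite upTo≡range L = on-range m mk
    where
    on-range : ∀ m → m ≤ k → length (filterᵇ (λ p → memb p (picked m)) (range 0 L)) ≡ m
    on-range zero _ = cong length (filterᵇ-false (range 0 L))
    on-range (suc m) mk =
      trans (length-filterᵇ-insert 0 L (pick (suc m)) (λ p → memb p (picked m)) z≤n (pick-in-range (suc m) (s≤s z≤n) mk) (pick-fresh m mk))
            (cong suc (on-range m (<⇒≤ mk)))

  k≤L : k ≤ L
  k≤L = subst₂ _≤_ (length-selected k ≤-refl) (length-upTo L) (length-filter (λ p → T? (memb p (picked k))) (upTo L))

  -- extend really collects all k picks: the search for c+1 on w with the
  -- picks blanked sees the same positions as on u₀, and above k nothing is left.
  avail-after-picks : ∀ c h → c ≤ k → avail w (picked c ++ U) (suc c) h ≡ avail w U (suc c) h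
  avail-after-picks c h ck = trans (avail≡blanked w (picked c ++ U) (suc c) h (λ ()))
                       (trans (afterPicks-test c (suc c) h ≤-refl ck) (sym (avail≡blanked w U (suc c) h (λ ()))))

  nextPos-none : ∀ U′ c p → (∀ h → avail w U′ c h ≡ false) → nextPos w U′ c p ≡ nothing
  nextPos-none U′ c p none with nextPos w U′ c p in e
  ... | nothing = refl
  ... | just q = ⊥-elim (true≢false (trans (sym (proj₁ (Search.nextPos-hit w U′ c p q e))) (none q)))

  nothing-above-k : ∀ h → avail w (picked k ++ U) (suc k) h ≡ false
  nothing-above-k h = trans (avail≡blanked w (picked k ++ U) (suc k) h (λ ()))
    (trans (afterPicks-test k (suc k) h ≤-refl ≤-refl)
           (≢⇒≡ᵇ-false _ (suc k) (λ e → <⇒≱ (s≤s ≤-refl) (subst (_≤ k) e (blanked-≤ h)))))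

  extend-picks : ∀ fuel c → 1 ≤ c → c ≤ k → k ≤ c + fuel → extend fuel w U c (pick c) (picked c) ≡ picked k
  extend-picks zero c c1 ck kc with ≤-antisym ck (subst (k ≤_) (+-identityʳ c) kc)
  ... | refl = refl
  extend-picks (suc fuel) c c1 ck kc with m≤n⇒m<n∨m≡n ck
  ... | inj₂ refl rewrite nextPos-none (picked c ++ U) (suc c) (pick c) nothing-above-k = refl
  ... | inj₁ lt rewrite trans (nextPos-cong w (picked c ++ U) U (suc c) (λ h → avail-after-picks c h ck) (pick c)) (pick-next c c1 lt) =
        extend-picks fuel (suc c) (s≤s z≤n) lt (subst (k ≤_) (+-suc c fuel) kc)

  extract≡picked : 1 ≤ k → extractPositions w U ≡ picked k
  extract≡picked k≥1 rewrite pick-first k≥1 = extend-picks L 1 ≤-refl k≥1 (≤-trans k≤L (n≤1+n L))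

  -- The subword read off: its letter j sits at the place of pick j among the
  -- selected positions, so the order of j and j+1 in it is that of their picks.
  pick-selected : ∀ i → 1 ≤ i → i ≤ k → pick i ∈ selected k
  pick-selected i i1 ik = ∈-filter⁺ (λ p → T? (memb p (picked k))) (∈-upTo⁺ (pick-in-range i i1 ik)) (≡true⇒T (memb-picked k i i1 ik))

  selected-unique : ∀ j → 1 ≤ j → j ≤ k → ∀ x → x ∈ selected k → letterAt w x ≡ j → x ≡ pick j
  selected-unique j j1 jk x m e with memb-picked⁻ k x (T⇒≡true (proj₂ (∈-filter⁻ (λ p → T? (memb p (picked k))) {xs = upTo L} m)))
  ... | i , i1 , ik , refl with trans (sym (proj₁ (pick-in-word i i1 ik))) e
  ... | refl = refl

  selected-increasing : AllPairs _<_ (selected k)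
  selected-increasing = filter⁺ (λ p → T? (memb p (picked k))) (applyUpTo⁺₁ id L (λ i<j _ → i<j))

  subword : List ℕ
  subword = lettersAt w (picked k)

  posOf-pick-order : ∀ j → 1 ≤ j → suc j ≤ k → (posOf j subword <ᵇ posOf (suc j) subword) ≡ (pick j <ᵇ pick (suc j))
  posOf-pick-order j j1 jk =
    posOf-order (letterAt w) j (suc j) (pick j) (pick (suc j)) (selected k) selected-increasing
       (pick-selected j j1 (<⇒≤ jk)) (pick-selected (suc j) (s≤s z≤n) jk)
       (proj₁ (pick-in-word j j1 (<⇒≤ jk))) (proj₁ (pick-in-word (suc j) (s≤s z≤n) jk)) (λ e → 1+n≢n (sym e))
       (selected-unique j j1 (<⇒≤ jk)) (selected-unique (suc j) (s≤s z≤n) jk)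

  -- [p_j < p_{j+1}]: the search for j+1 wrapped around.
  ascent : ℕ → ℕ
  ascent j = bit (pick j <ᵇ pick (suc j))

  charge-round : chargePerm subword ≡ sum (map (λ j → ascent j * (k ∸ j)) (oneTo (k ∸ 1)))
  charge-round = trans (chargePerm-formula subword k (trans (length-map (letterAt w) (selected k)) (length-selected k ≤-refl)))
    (sum-oneTo-cong (k ∸ 1) _ _ (λ i lt → cong (λ z → bit z * (k ∸ suc i)) (posOf-pick-order (suc i) (s≤s z≤n) (below-k k i lt))))

  module Pair (j′ : ℕ) (jk : suc (suc j′) ≤ k) where
    j = suc j′
    open MaxExcess j (λ ())

    j≤k : j ≤ k
    j≤k = <⇒≤ jk

    -- The picks of 1, …, j-1 and of j+2, …, k carry other letters.
    maxExcess-before-pair : ∀ m → m < j → maxExcess j (afterPicks m) ≡ maxExcess j u₀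
    maxExcess-before-pair zero _ = refl
    maxExcess-before-pair (suc m) lt rewrite afterPicks-suc m =
      trans (maxExcess-erase-other (pick (suc m)) (afterPicks m) (λ e → <⇒≢ lt (trans (sym picked-letter) e))
                                                (λ e → <⇒≢ (<-trans lt (n<1+n j)) (trans (sym picked-letter) e)))
            (maxExcess-before-pair m (<-trans (n<1+n m) lt))
      where
      picked-letter = afterPicks-unpicked m (suc m) ≤-refl (≤-trans (<⇒≤ lt) j≤k)

    maxExcess-after-pair : ∀ m → suc j ≤ m → m ≤ k → maxExcess j (afterPicks m) ≡ maxExcess j (afterPicks (suc j))
    maxExcess-after-pair zero () _
    maxExcess-after-pair (suc m) le mk with m≤n⇒m<n∨m≡n le
    ... | inj₂ refl = refl
    ... | inj₁ lt rewrite afterPicks-suc m =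
      trans (maxExcess-erase-other (pick (suc m)) (afterPicks m) (λ e → <⇒≢ (<-trans (n<1+n j) lt) (sym (trans (sym picked-letter) e)))
                                                (λ e → <⇒≢ lt (sym (trans (sym picked-letter) e))))
            (maxExcess-after-pair m (≤-pred lt) (<⇒≤ mk))
      where
      picked-letter = afterPicks-unpicked m (suc m) ≤-refl mk

    u = afterPicks j′
    α = pick j
    β = pick (suc j)

    eα : letterAt u α ≡ j
    eα = afterPicks-unpicked j′ j (n<1+n j′) j≤k
    eβ : letterAt u β ≡ suc j
    eβ = afterPicks-unpicked j′ (suc j) (<-trans (n<1+n j′) (n<1+n j)) jk

    unavailable⇒no-upper : ∀ h → avail w U (suc j) h ≡ false → letterAt u h ≢ suc j
    unavailable⇒no-upper h a e = true≢false (trans (sym (subst (λ z → (z ≡ᵇ suc j) ≡ true) (sym e) (≡ᵇ-refl (suc j))))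
                      (trans (afterPicks-test j′ (suc j) h (<-trans (n<1+n j′) (n<1+n j)) (<⇒≤ j≤k))
                        (≢⇒≡ᵇ-false _ (suc j) (unavailable⇒letter (suc j) h (s≤s z≤n) a))))

    balanced-pair : count j u ≡ count (suc j) u
    balanced-pair = trans (count-afterPicks-later j′ j (n<1+n j′) j≤k)
      (trans (balanced j (s≤s z≤n) j≤k)
        (sym (trans (count-afterPicks-later j′ (suc j) (<-trans (n<1+n j′) (n<1+n j)) jk) (balanced (suc j) (s≤s z≤n) jk))))

    maxExcess-pair : maxExcess j u ≡ ascent j + maxExcess j (erase β (erase α u))
    maxExcess-pair with Search.nextPos-hit w U (suc j) α β (pick-next j (s≤s z≤n) jk)
    ... | _ , inj₁ (β<α , between) rewrite ≥⇒<ᵇ-false α β (<⇒≤ β<α) =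
          sym (maxExcess-erase-nested β α u β<α eβ eα (λ h a b → unavailable⇒no-upper h (between h a b)))
    ... | _ , inj₂ (α<β , before , after) rewrite <⇒<ᵇ-true α β α<β =
          sym (maxExcess-erase-wrapped α β u α<β eα eβ (λ h lt → unavailable⇒no-upper h (before h lt))
                                                     (λ h lt → unavailable⇒no-upper h (after h lt)) balanced-pair)

    maxExcess-round : maxExcess j u₀ ≡ ascent j + maxExcess j (afterPicks k)
    maxExcess-round = begin
      maxExcess j u₀                                    ≡⟨ sym (maxExcess-before-pair j′ (n<1+n j′)) ⟩
      maxExcess j u                                     ≡⟨ maxExcess-pair ⟩
      ascent j + maxExcess j (erase β (erase α u))      ≡⟨ cong (λ z → ascent j + maxExcess j z) pair-erased ⟩
      ascent j + maxExcess j (afterPicks (suc j))       ≡⟨ cong (ascent j +_) (sym (maxExcess-after-pair k jk ≤-refl)) ⟩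
      ascent j + maxExcess j (afterPicks k)             ∎
      where
      open ≡-Reasoning
      pair-erased : erase β (erase α u) ≡ afterPicks (suc j)
      pair-erased = sym (trans (afterPicks-suc j) (cong (erase β) (afterPicks-suc j′)))

charge-from : ∀ k w → (∀ h → h < length w → 1 ≤ letterAt w h × letterAt w h ≤ k) → 1 ≤ k
  → ∀ f U → (∀ c → 1 ≤ c → c ≤ k → count c (blanked w U) ≡ f)
  → sum (map chargePerm (subwordsFrom f w U)) ≡ sum (map (λ j → maxExcess j (blanked w U) * (k ∸ j)) (oneTo (k ∸ 1)))
charge-from k w letters k≥1 zero U balanced = sym (sum-oneTo-zero (k ∸ 1) _ no-upper)
  where
  no-upper : ∀ i → i < k ∸ 1 → maxExcess (suc i) (blanked w U) * (k ∸ suc i) ≡ 0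
  no-upper i lt = cong (_* (k ∸ suc i))
    (MaxExcess.maxExcess-no-upper (suc i) (λ ()) (blanked w U) (balanced (suc (suc i)) (s≤s z≤n) (below-k k i lt)))
charge-from k w letters k≥1 (suc f) U balanced = begin
  sum (map chargePerm (subwordsFrom (suc f) w U))
    ≡⟨ cong (λ ps → chargePerm (lettersAt w ps) + sum (map chargePerm (subwordsFrom f w (ps ++ U)))) (R.extract≡picked k≥1) ⟩
  chargePerm R.subword + sum (map chargePerm (subwordsFrom f w (R.picked k ++ U)))
    ≡⟨ cong₂ _+_ R.charge-round (charge-from k w letters k≥1 f (R.picked k ++ U) R.balanced-next) ⟩
  sum (map (λ j → R.ascent j * (k ∸ j)) (oneTo (k ∸ 1))) + sum (map (λ j → maxExcess j (R.afterPicks k) * (k ∸ j)) (oneTo (k ∸ 1)))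
    ≡⟨ sym (sum-+-distrib (oneTo (k ∸ 1)) R.ascent (λ j → maxExcess j (R.afterPicks k)) (λ j → k ∸ j)) ⟩
  sum (map (λ j → (R.ascent j + maxExcess j (R.afterPicks k)) * (k ∸ j)) (oneTo (k ∸ 1)))
    ≡⟨ sum-oneTo-cong (k ∸ 1) _ _ (λ i lt → cong (_* (k ∸ suc i)) (sym (R.Pair.maxExcess-round i (below-k k i lt)))) ⟩
  sum (map (λ j → maxExcess j (blanked w U) * (k ∸ j)) (oneTo (k ∸ 1))) ∎
  where
  open ≡-Reasoning
  module R = Round k w letters U f balanced

letterAt-bounds : ∀ {P : ℕ → Set} w → All P w → ∀ h → h < length w → P (letterAt w h)
letterAt-bounds (x ∷ w) (p ∷ a) zero _ = p
letterAt-bounds (x ∷ w) (p ∷ a) (suc h) (s≤s lt) = letterAt-bounds w a h lt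

mainTheorem4 : (k n : ℕ) (w : List ℕ)
    → All (λ x → 1 ≤ x × x ≤ k) w
    → (∀ j → 1 ≤ j → j ≤ k → occ j w ≡ n)
    → charge w ≡ depthSum k w
mainTheorem4 zero n [] _ _ = refl
mainTheorem4 zero n (x ∷ w) ((1≤x , x≤0) ∷ _) _ = ⊥-elim (<⇒≱ (≤-trans 1≤x x≤0) z≤n)
mainTheorem4 (suc k′) n w letters occurrences = begin
  charge w
    ≡⟨ charge-from k w (letterAt-bounds w letters) (s≤s z≤n) (occ 1 w) [] balanced ⟩
  sum (map (λ j → maxExcess j (blanked w []) * (k ∸ j)) (oneTo (k ∸ 1)))
    ≡⟨ sum-oneTo-cong (k ∸ 1) _ _ (λ i _ → cong (_* (k ∸ suc i)) (maxExcess≡depth i)) ⟩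
  depthSum k w ∎
  where
  open ≡-Reasoning
  k = suc k′
  balanced : ∀ c → 1 ≤ c → c ≤ k → count c (blanked w []) ≡ occ 1 w
  balanced c c1 ck = begin
    count c (blanked w [])  ≡⟨ cong (count c) (mask-nil 0 w) ⟩
    count c w               ≡⟨ sym (occ≡count c w) ⟩
    occ c w                 ≡⟨ occurrences c c1 ck ⟩
    n                       ≡⟨ sym (occurrences 1 ≤-refl (s≤s z≤n)) ⟩
    occ 1 w                 ∎
  maxExcess≡depth : ∀ i → maxExcess (suc i) (blanked w []) ≡ depth (suc i) w
  maxExcess≡depth i = trans (cong (maxExcess (suc i)) (mask-nil 0 w)) (sym (Depth.depth≡maxExcess (suc i) (λ ()) w))
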